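{- Let $G$ be a connected finite $\delta$-hyperbolic graph, and let $z$ be a vertex, $x\in F(z)$, $y\in F(x)$. Every vertex $c\in S_{\lceil d(x,y)/2\rceil}(x,y)\cup S_{\lceil d(x,y)/2\rceil}(y,x)$ satisfies $C_{\le k}(G)\subseteq D(c,5\delta+1+k)$ for every integer $k\ge 0$. In particular, $C(G)\subseteq D(c,5\delta+1)$.
   Context: $G$ is $\delta$-hyperbolic if for any four vertices $u,v,w,x$ the two larger of $d(u,v)+d(w,x)$, $d(u,w)+d(v,x)$, $d(u,x)+d(v,w)$ differ by at most $2\delta$ ($d$ = shortest-path distance). $e(v)=\max_u d(v,u)$, $F(v)=\{u:d(u,v)=e(v)\}$, $rad(G)=\min_v e(v)$, $C_{\le k}(G)=\{v:e(v)\le rad(G)+k\}$, $C(G)=C_{\le0}(G)$, $D(c,r)=\{u: d(u,c)\le r\}$. $I(x,y)=\{w: d(x,w)+d(w,y)=d(x,y)\}$, $S_k(x,y)=\{v\in I(x,y): d(v,x)=k\}$. -}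

module Defs where

open import Data.Nat using (ℕ; zero; suc; _+_; _*_; _≤_; _⊔_; _⊓_)
open import Data.Fin using (Fin; zero; suc)
open import Data.Product using (_×_; Σ)
open import Relation.Binary.PropositionalEquality using (_≡_)
open import Relation.Nullary using (¬_)
open import Function using (_∘_)

Fin′ : ℕ → Set
Fin′ n = Fin (suc n)

record Graph (n : ℕ) : Set₁ where
  field
    E     : Fin (suc n) → Fin (suc n) → Set
    sym   : ∀ {u v} → E u v → E v u
    irrefl : ∀ {u} → ¬ E u u

module _ {n : ℕ} (G : Graph n) where
  open Graph G
  private V = Fin (suc n)

  data Walk : V → V → ℕ → Set where
    here : ∀ {u} → Walk u u 0
    step : ∀ {u w v m} → E u w → Walk w v m → Walk u v (suc m)

  -- d is the shortest-path distance of G (its existence for all pairs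
  -- means G is connected)
  IsDistance : (V → V → ℕ) → Set
  IsDistance d = ∀ u v → Walk u v (d u v) × (∀ m → Walk u v m → d u v ≤ m)

  Connected : Set
  Connected = ∀ u v → Σ ℕ (Walk u v)

maxOver : ∀ {n} → (Fin n → ℕ) → ℕ
maxOver {zero} f = 0
maxOver {suc n} f = f zero ⊔ maxOver (f ∘ suc)

minOver : ∀ {n} → (Fin (suc n) → ℕ) → ℕ
minOver {zero} f = f zero
minOver {suc n} f = f zero ⊓ minOver (f ∘ suc)

module Metric {n : ℕ} (d : Fin (suc n) → Fin (suc n) → ℕ) where
  private V = Fin (suc n)

  -- δ-hyperbolicity with 2δ = h : the largest of the three sums is at most
  -- the second largest (the median) plus h
  Hyperbolic2 : ℕ → Set
  Hyperbolic2 h = ∀ u v w x →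
    let s₁ = d u v + d w x
        s₂ = d u w + d v x
        s₃ = d u x + d v w
    in (s₁ ⊔ s₂ ⊔ s₃) ≤ ((s₁ ⊓ s₂) ⊔ (s₂ ⊓ s₃) ⊔ (s₁ ⊓ s₃)) + h

  ecc : V → ℕ
  ecc v = maxOver (d v)

  F : V → V → Set
  F v u = d u v ≡ ecc v

  rad : ℕ
  rad = minOver ecc

  C≤ : ℕ → V → Set
  C≤ k v = ecc v ≤ rad + k

  I : V → V → V → Set
  I x y w = d x w + d w y ≡ d x y

  S : ℕ → V → V → V → Set
  S k x y v = I x y v × d v x ≡ k

-- Write D = d(x,y) and h = 2δ.  As y is farthest from x, every vertex w lies
-- within D of x; as x is farthest from z, the four-point condition on x, y, z, w
-- puts w within D + h of y.  Hence the point of an (x,y)-geodesic at distance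
-- ⌊(D − h)/2⌋ from x has eccentricity at most ⌈(D − h)/2⌉ + 2h, so that
-- 2·rad ≤ D + 3h + 1.  For u ∈ C≤k, the four-point condition on u, c, x, y gives
-- d(u,c) + D ≤ ecc(u) + ⌈D/2⌉ + h with ecc(u) ≤ rad + k; doubling it and adding
-- the bound on 2·rad, D cancels.

module Submission where

open import Defs
open import Data.Nat
  using (ℕ; zero; suc; _+_; _*_; _∸_; _⊔_; _⊓_; _≤_; z≤n; s≤s; _≤?_; ⌊_/2⌋; ⌈_/2⌉)
open import Data.Nat.Properties
open import Data.Nat.Tactic.RingSolver using (solve-∀)
open import Data.Fin using (Fin)
open import Data.Product using (∃; _×_; _,_; proj₁; proj₂; swap)
open import Data.Sum using (_⊎_; inj₁; inj₂)
open import Relation.Nullary using (yes; no)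
open import Relation.Binary.PropositionalEquality

maxOver-upper : ∀ {n} (f : Fin n → ℕ) i → f i ≤ maxOver f
maxOver-upper {suc n} f Fin.zero    = m≤m⊔n _ _
maxOver-upper {suc n} f (Fin.suc i) =
  ≤-trans (maxOver-upper (λ j → f (Fin.suc j)) i) (m≤n⊔m _ _)

maxOver-least : ∀ {n} (f : Fin n → ℕ) {B} → (∀ i → f i ≤ B) → maxOver f ≤ B
maxOver-least {zero}  f f≤B = z≤n
maxOver-least {suc n} f f≤B =
  ⊔-lub (f≤B Fin.zero) (maxOver-least (λ j → f (Fin.suc j)) (λ j → f≤B (Fin.suc j)))

minOver-lower : ∀ {n} (f : Fin (suc n) → ℕ) i → minOver f ≤ f i
minOver-lower {zero}  f Fin.zero    = ≤-refl
minOver-lower {suc n} f Fin.zero    = m⊓n≤m _ _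
minOver-lower {suc n} f (Fin.suc i) =
  ≤-trans (m⊓n≤n _ _) (minOver-lower (λ j → f (Fin.suc j)) i)

⌈n/2⌉≤1+⌊n/2⌋ : ∀ n → ⌈ n /2⌉ ≤ suc ⌊ n /2⌋
⌈n/2⌉≤1+⌊n/2⌋ zero          = z≤n
⌈n/2⌉≤1+⌊n/2⌋ (suc zero)    = ≤-refl
⌈n/2⌉≤1+⌊n/2⌋ (suc (suc n)) = s≤s (⌈n/2⌉≤1+⌊n/2⌋ n)

⌈n/2⌉+⌈n/2⌉≤1+n : ∀ n → ⌈ n /2⌉ + ⌈ n /2⌉ ≤ suc n
⌈n/2⌉+⌈n/2⌉≤1+n n = begin
  ⌈ n /2⌉ + ⌈ n /2⌉       ≤⟨ +-monoˡ-≤ ⌈ n /2⌉ (⌈n/2⌉≤1+⌊n/2⌋ n) ⟩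
  suc ⌊ n /2⌋ + ⌈ n /2⌉   ≡⟨ cong suc (⌊n/2⌋+⌈n/2⌉≡n n) ⟩
  suc n                   ∎
  where open ≤-Reasoning

n≤⌈n/2⌉+⌈n/2⌉ : ∀ n → n ≤ ⌈ n /2⌉ + ⌈ n /2⌉
n≤⌈n/2⌉+⌈n/2⌉ n = begin
  n                   ≡⟨ ⌊n/2⌋+⌈n/2⌉≡n n ⟨
  ⌊ n /2⌋ + ⌈ n /2⌉   ≤⟨ +-monoˡ-≤ ⌈ n /2⌉ (⌊n/2⌋≤⌈n/2⌉ n) ⟩
  ⌈ n /2⌉ + ⌈ n /2⌉   ∎
  where open ≤-Reasoning

⌈n/2⌉+m≡n⇒m≤⌈n/2⌉ : ∀ {n m} → ⌈ n /2⌉ + m ≡ n → m ≤ ⌈ n /2⌉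
⌈n/2⌉+m≡n⇒m≤⌈n/2⌉ {n} eq =
  +-cancelˡ-≤ ⌈ n /2⌉ _ _ (subst (_≤ ⌈ n /2⌉ + ⌈ n /2⌉) (sym eq) (n≤⌈n/2⌉+⌈n/2⌉ n))

median : ℕ → ℕ → ℕ → ℕ
median s₁ s₂ s₃ = (s₁ ⊓ s₂) ⊔ (s₂ ⊓ s₃) ⊔ (s₁ ⊓ s₃)

max≤median+h⇒≤ : ∀ {s₁ s₂ s₃ h M} → s₁ ⊔ s₂ ⊔ s₃ ≤ median s₁ s₂ s₃ + h →
                 s₂ ≤ M → s₃ ≤ M → s₁ ≤ M + h
max≤median+h⇒≤ {s₁} {s₂} {s₃} {h} max≤ s₂≤M s₃≤M = begin
  s₁                      ≤⟨ ≤-trans (m≤m⊔n s₁ s₂) (m≤m⊔n (s₁ ⊔ s₂) s₃) ⟩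
  s₁ ⊔ s₂ ⊔ s₃            ≤⟨ max≤ ⟩
  median s₁ s₂ s₃ + h     ≤⟨ +-monoˡ-≤ h median≤M ⟩
  _                       ∎
  where
  open ≤-Reasoning
  median≤M : median s₁ s₂ s₃ ≤ _
  median≤M = ⊔-lub (⊔-lub (≤-trans (m⊓n≤n s₁ s₂) s₂≤M) (≤-trans (m⊓n≤m s₂ s₃) s₂≤M))
                   (≤-trans (m⊓n≤n s₁ s₃) s₃≤M)

twice-bound : ∀ {a D e r k A h} → a + D ≤ e + A + h → e ≤ r + k →
              r + r ≤ D + 3 * h + 1 → A + A ≤ suc D → 2 * a ≤ 5 * h + 2 + 2 * k
twice-bound {a} {D} {e} {r} {k} {A} {h} a+D≤ e≤ r+r≤ A+A≤ = +-cancelˡ-≤ (2 * D) _ _ (begin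
  2 * D + 2 * a                                 ≡⟨ lhs a D ⟩
  (a + D) + (a + D)                             ≤⟨ +-mono-≤ a+D≤ a+D≤ ⟩
  (e + A + h) + (e + A + h)                     ≤⟨ +-mono-≤ e+≤ e+≤ ⟩
  (r + k + A + h) + (r + k + A + h)             ≡⟨ middle r k A h ⟩
  (r + r) + (A + A) + (2 * k + 2 * h)           ≤⟨ +-monoˡ-≤ _ (+-mono-≤ r+r≤ A+A≤) ⟩
  (D + 3 * h + 1) + suc D + (2 * k + 2 * h)     ≡⟨ rhs D h k ⟩
  2 * D + (5 * h + 2 + 2 * k)                   ∎)
  where
  open ≤-Reasoning
  e+≤ : e + A + h ≤ r + k + A + h
  e+≤ = +-monoˡ-≤ h (+-monoˡ-≤ A e≤)
  lhs : ∀ a D → 2 * D + 2 * a ≡ (a + D) + (a + D)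
  lhs = solve-∀
  middle : ∀ r k A h → (r + k + A + h) + (r + k + A + h) ≡ (r + r) + (A + A) + (2 * k + 2 * h)
  middle = solve-∀
  rhs : ∀ D h k → (D + 3 * h + 1) + suc D + (2 * k + 2 * h) ≡ 2 * D + (5 * h + 2 + 2 * k)
  rhs = solve-∀

module Walks {n : ℕ} (G : Graph n) where
  open Graph G using (E) renaming (sym to E-sym)

  snoc : ∀ {u v w m} → Walk G u v m → E v w → Walk G u w (suc m)
  snoc here       e = step e here
  snoc (step f p) e = step f (snoc p e)

  reverse : ∀ {u v m} → Walk G u v m → Walk G v u m
  reverse here       = here
  reverse (step e p) = snoc (reverse p) (E-sym e)

  splitAt : ∀ {u v} j l → Walk G u v (j + l) → ∃ λ w → Walk G u w j × Walk G w v l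
  splitAt zero    l p          = _ , here , p
  splitAt (suc j) l (step e p) with splitAt j l p
  ... | w , q , r = w , step e q , r

module ShortestPaths {n : ℕ} (G : Graph n) (d : Fin′ n → Fin′ n → ℕ) (isD : IsDistance G d) where
  open Walks G

  d≤length : ∀ {u v m} → Walk G u v m → d u v ≤ m
  d≤length {u} {v} p = proj₂ (isD u v) _ p

  d-sym : ∀ u v → d u v ≡ d v u
  d-sym u v = ≤-antisym (d≤length (reverse (proj₁ (isD v u))))
                        (d≤length (reverse (proj₁ (isD u v))))

  geodesic-split : ∀ x y j l → d x y ≡ j + l → ∃ λ c → d x c ≤ j × d c y ≤ l
  geodesic-split x y j l eq with splitAt j l (subst (Walk G x y) eq (proj₁ (isD x y)))
  ... | c , p , q = c , d≤length p , d≤length q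

  open Metric d

  midpoint-close : ∀ {x y c} → S ⌈ d x y /2⌉ x y c →
                   d c x ≤ ⌈ d x y /2⌉ × d c y ≤ ⌈ d x y /2⌉
  midpoint-close {x} {y} {c} (xcy , cx) = ≤-reflexive cx , ⌈n/2⌉+m≡n⇒m≤⌈n/2⌉
    (trans (cong (_+ d c y) (trans (sym cx) (d-sym c x))) xcy)

  midpoint-close-either : ∀ {x y c} → S ⌈ d x y /2⌉ x y c ⊎ S ⌈ d x y /2⌉ y x c →
                          d c x ≤ ⌈ d x y /2⌉ × d c y ≤ ⌈ d x y /2⌉
  midpoint-close-either (inj₁ c∈Sxy) = midpoint-close c∈Sxy
  midpoint-close-either {x} {y} {c} (inj₂ c∈Syx) =
    swap (subst (λ D → d c y ≤ ⌈ D /2⌉ × d c x ≤ ⌈ D /2⌉) (d-sym y x)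
           (midpoint-close (subst (λ D → S ⌈ D /2⌉ y x c) (d-sym x y) c∈Syx)))

  module Hyperbolic (h : ℕ) (hyp : Hyperbolic2 h) where

    four-point : ∀ {u v w x M} → d u w + d v x ≤ M → d u x + d v w ≤ M →
                 d u v + d w x ≤ M + h
    four-point {u} {v} {w} {x} = max≤median+h⇒≤ (hyp u v w x)

    near-both-ends : ∀ {x y c A} → d c x ≤ A → d c y ≤ A →
                     ∀ u → d u c + d x y ≤ ecc u + A + h
    near-both-ends {x} {y} {c} cx≤ cy≤ u = four-point
      (+-mono-≤ (maxOver-upper (d u) x) cy≤)
      (+-mono-≤ (maxOver-upper (d u) y) cx≤)

    ecc-on-geodesic : ∀ {x y c q r} → (∀ w → d x w ≤ d x y) → (∀ w → d y w ≤ d x y + h) →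
                      d x c ≤ q → d c y ≤ h + r → q ≤ r → ecc c ≤ h + r + h
    ecc-on-geodesic {x} {y} {c} {q} {r} x-far y-far xc≤ cy≤ q≤r =
      maxOver-least (d c) λ w → +-cancelʳ-≤ (d x y) _ _
        (subst (d c w + d x y ≤_) (regroup h r (d x y))
          (four-point (cx+wy w) (+-mono-≤ cy≤ (subst (_≤ d x y) (d-sym x w) (x-far w)))))
      where
      open ≤-Reasoning
      regroup : ∀ h r D → h + r + D + h ≡ h + r + h + D
      regroup = solve-∀
      cx+wy : ∀ w → d c x + d w y ≤ h + r + d x y
      cx+wy w = begin
        d c x + d w y       ≤⟨ +-mono-≤ (subst (_≤ q) (d-sym x c) xc≤)
                                        (subst (_≤ d x y + h) (d-sym y w) (y-far w)) ⟩
        q + (d x y + h)     ≤⟨ +-monoˡ-≤ _ q≤r ⟩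
        r + (d x y + h)     ≡⟨ shuffle r (d x y) h ⟩
        h + r + d x y       ∎
        where
        shuffle : ∀ r D h → r + (D + h) ≡ h + r + D
        shuffle = solve-∀

    module Diametral (z x y : Fin′ n) (x∈Fz : F z x) (y∈Fx : F x y) where

      ecc-x : ecc x ≡ d x y
      ecc-x = trans (sym y∈Fx) (d-sym y x)

      x-far : ∀ w → d x w ≤ d x y
      x-far w = subst (d x w ≤_) ecc-x (maxOver-upper (d x) w)

      z-far : ∀ w → d z w ≤ d x z
      z-far w = subst (d z w ≤_) (sym x∈Fz) (maxOver-upper (d z) w)

      y-far : ∀ w → d y w ≤ d x y + h
      y-far w = +-cancelˡ-≤ (d x z) _ _ (subst (d x z + d y w ≤_) (regroup (d x y) (d x z) h)
        (four-point (+-monoʳ-≤ (d x y) (z-far w)) (+-mono-≤ (x-far w) (z-far y))))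
        where
        regroup : ∀ D a h → D + a + h ≡ a + (D + h)
        regroup = solve-∀

      rad-bound : rad + rad ≤ d x y + 3 * h + 1
      rad-bound with h ≤? d x y
      ... | no h≰D = begin
        rad + rad              ≤⟨ +-mono-≤ rad≤D (≤-trans rad≤D (≤-trans D≤h (m≤m+n h (2 * h)))) ⟩
        d x y + 3 * h          ≤⟨ m≤m+n _ 1 ⟩
        d x y + 3 * h + 1      ∎
        where
        open ≤-Reasoning
        D≤h : d x y ≤ h
        D≤h = ≰⇒≥ h≰D
        rad≤D : rad ≤ d x y
        rad≤D = subst (rad ≤_) ecc-x (minOver-lower ecc x)
      ... | yes h≤D = begin
        rad + rad                          ≤⟨ +-mono-≤ rad≤ rad≤ ⟩
        (h + r + h) + (h + r + h)          ≡⟨ regroup h r ⟩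
        (r + r) + 4 * h                    ≤⟨ +-monoˡ-≤ (4 * h) (⌈n/2⌉+⌈n/2⌉≤1+n t) ⟩
        suc t + 4 * h                      ≡⟨ shift h t ⟩
        (h + t) + 3 * h + 1                ≡⟨ cong (λ D → D + 3 * h + 1) (m+[n∸m]≡n h≤D) ⟩
        d x y + 3 * h + 1                  ∎
        where
        open ≤-Reasoning
        t = d x y ∸ h
        q = ⌊ t /2⌋
        r = ⌈ t /2⌉
        regroup : ∀ h r → (h + r + h) + (h + r + h) ≡ (r + r) + 4 * h
        regroup = solve-∀
        shift : ∀ h t → suc t + 4 * h ≡ (h + t) + 3 * h + 1
        shift = solve-∀
        exchange : ∀ a b c → a + (b + c) ≡ b + (a + c)
        exchange = solve-∀
        D≡q+[h+r] : d x y ≡ q + (h + r)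
        D≡q+[h+r] = begin-equality
          d x y          ≡⟨ m+[n∸m]≡n h≤D ⟨
          h + t          ≡⟨ cong (h +_) (⌊n/2⌋+⌈n/2⌉≡n t) ⟨
          h + (q + r)    ≡⟨ exchange h q r ⟩
          q + (h + r)    ∎
        rad≤ : rad ≤ h + r + h
        rad≤ with geodesic-split x y q (h + r) D≡q+[h+r]
        ... | c , xc≤ , cy≤ = ≤-trans (minOver-lower ecc c)
                (ecc-on-geodesic x-far y-far xc≤ cy≤ (⌊n/2⌋≤⌈n/2⌉ t))

lemma33 : ∀ {n} (G : Graph n) (d : Fin′ n → Fin′ n → ℕ) → Connected G → IsDistance G d →
    let open Metric d in
    (h : ℕ) → Hyperbolic2 h →
    ∀ z x y → F z x → F x y →
    ∀ c → S ⌈ d x y /2⌉ x y c ⊎ S ⌈ d x y /2⌉ y x c →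
    ∀ (k : ℕ) u → C≤ k u → 2 * d u c ≤ 5 * h + 2 + 2 * k
lemma33 G d _ isD h hyp z x y x∈Fz y∈Fx c c∈S k u u∈C≤k =
  twice-bound {r = rad} {k = k}
    (near-both-ends cx≤ cy≤ u) u∈C≤k rad-bound (⌈n/2⌉+⌈n/2⌉≤1+n (d x y))
  where
  open Metric d using (rad)
  open ShortestPaths G d isD
  open Hyperbolic h hyp
  open Diametral z x y x∈Fz y∈Fx
  cx≤ : d c x ≤ ⌈ d x y /2⌉
  cx≤ = proj₁ (midpoint-close-either c∈S)
  cy≤ : d c y ≤ ⌈ d x y /2⌉
  cy≤ = proj₂ (midpoint-close-either c∈S)
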